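{- Let $n\ge1$ and let $\pi=\pi(1)\cdots\pi(2n)$ be a standard permutation of $\{\pm1,\ldots,\pm n\}$. Then $\pi$ is sign-disconnected if and only if there exists $i\in\{1,\ldots,n-1\}$ such that $|\pi(j)|\le i$ for all $j\le 2i$ (equivalently, $|\pi(j)|\ge i+1$ for all $j>2i$).
   Context: A standard permutation of $\{\pm1,\ldots,\pm n\}$ is a word in which each element of $\{\pm1,\ldots,\pm n\}$ appears exactly once, such that for every $i$, $i$ occurs before $-i$, and the negative entries occur in the order $-1,-2,\ldots,-n$. A permutation $\pi$ of $\{\pm1,\ldots,\pm n\}$ is sign-connected if for every $1\le m<2n$ there is at least one $j\in\{1,\ldots,n\}$ with $|\{\pi(1),\ldots,\pi(m)\}\cap\{ -j,j\}|=1$; otherwise it is sign-disconnected. -}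

module Defs where

open import Data.Nat using (ℕ; zero; suc; _+_; _*_; _≤_; _<_; _∸_)
open import Data.Integer using (ℤ; +_; -[1+_]; -_; ∣_∣; _<?_; 0ℤ)
open import Data.List using (List; length; take; filter; map; upTo; _++_)
open import Data.List.Membership.Propositional using (_∈_; _∉_)
open import Data.List.Relation.Unary.All using (All)
open import Data.List.Relation.Unary.Unique.Propositional using (Unique)
open import Data.Product using (_×_; Σ; ∃; ∃-syntax; _,_)
open import Data.Sum using (_⊎_)
open import Relation.Binary.PropositionalEquality using (_≡_)
open import Relation.Nullary using (¬_)

-- A word over ℤ; the element ±k of {±1,…,±n} is the integer ±k.
Word : Set
Word = List ℤ

InSigned : ℕ → ℤ → Set
InSigned n x = ¬ (x ≡ 0ℤ) × ∣ x ∣ ≤ n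

IsSignedPerm : ℕ → Word → Set
IsSignedPerm n w =
  All (InSigned n) w × Unique w × (∀ x → InSigned n x → x ∈ w)

OccursBefore : ℤ → ℤ → Word → Set
OccursBefore a b w = ∃[ u ] ∃[ v ] (w ≡ u ++ v × a ∈ u × b ∈ v)

negatives : ℕ → List ℤ
negatives n = map (λ k → -[1+ k ]) (upTo n)

IsStandard : ℕ → Word → Set
IsStandard n w =
  IsSignedPerm n w
  × (∀ i → 1 ≤ i → i ≤ n → OccursBefore (+ i) (- (+ i)) w)
  × filter (λ x → x <? 0ℤ) w ≡ negatives n

ExactlyOneOf : ℕ → List ℤ → Set
ExactlyOneOf j p =
  (+ j ∈ p × - (+ j) ∉ p) ⊎ (+ j ∉ p × - (+ j) ∈ p)

-- π(1)…π(m) = take m w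
SignConnected : ℕ → Word → Set
SignConnected n w =
  ∀ m → 1 ≤ m → m < 2 * n →
    ∃[ j ] (1 ≤ j × j ≤ n × ExactlyOneOf j (take m w))

SignDisconnected : ℕ → Word → Set
SignDisconnected n w = ¬ SignConnected n w

module Submission where

-- Let π be a standard permutation of {±1,…,±n} and p = π(1)…π(m) a prefix.
-- Call p balanced if for no 1 ≤ j ≤ n it contains exactly one of j, -j;
-- π is sign-disconnected exactly when some proper non-empty prefix is
-- balanced.
--
-- Since the negative letters of π occur in the order -1,-2,…,-n, the
-- negative letters of p are exactly -1,…,-k, k being their number.  If p is
-- balanced, each positive letter j of p is matched by -j, so p ⊆ {±1,…,±k},
-- and each -j with j ≤ k is matched by j, so {±1,…,±k} ⊆ p; as p has no
-- repeated letter, counting gives m = 2k, which is the right-hand side with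
-- i = k.  Conversely, if π(1)…π(2i) ⊆ {±1,…,±i} then counting shows that this
-- prefix is all of {±1,…,±i}, hence balanced.
--
-- Both sides of the
-- equivalence are decidable (bounded searches), which turns the negative
-- statement "not sign-connected" into an explicit witness.

open import Defs
open import Data.Nat using (ℕ; _≤_; _*_; _∸_)
open import Data.Integer using (∣_∣)
open import Data.List using (take)
open import Data.List.Relation.Unary.All using (All)
open import Data.Product using (_×_; ∃-syntax)
open import Function.Bundles using (_⇔_; mk⇔)

open import Data.Nat using (zero; suc; _+_; _<_; z≤n; s≤s; s≤s⁻¹; _≤?_)
open import Data.Nat.Properties
  using (≤-refl; ≤-trans; ≤-antisym; m≤n⇒m≤1+n; m≤n⇒m<n∨m≡n; m≤m+n; <⇒≤;
         <⇒≱; +-suc; *-suc; *-monoʳ-≤; *-monoʳ-<; *-cancelˡ-<; ∸-monoˡ-≤;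
         m≤n⇒m⊓n≡m; <-irrefl; anyUpTo?; module ≤-Reasoning)
open import Data.Integer as ℤ using (ℤ; +_; -[1+_]; -_; 0ℤ; _<?_; -<+)
open import Data.List using (List; []; _∷_; _++_; length; filter; drop; applyUpTo)
open import Data.List.Properties
  using (∷-injective; length-++; length-take; take++drop≡id;
         filter-++; map-upTo)
open import Data.List.Membership.Propositional using (_∈_)
open import Data.List.Membership.Propositional.Properties
  using (∈-∃++; ∈-++⁺ˡ; ∈-++⁺ʳ; ∈-++⁻; ∈-filter⁺; ∈-filter⁻; ∈-applyUpTo⁺; ∈-applyUpTo⁻)
open import Data.List.Membership.DecPropositional ℤ._≟_ using (_∈?_)
open import Data.List.Relation.Binary.Subset.Propositional using (_⊆_)
open import Data.List.Relation.Unary.Any using (here; there)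
open import Data.List.Relation.Unary.All as All using (_∷_; lookup; all?)
open import Data.List.Relation.Unary.All.Properties using (¬Any⇒All¬)
  renaming (take⁺ to all-take⁺)
open import Data.List.Relation.Unary.AllPairs using ([]; _∷_)
open import Data.List.Relation.Unary.Unique.Propositional using (Unique)
import Data.List.Relation.Unary.Unique.Propositional.Properties as Unique
open import Data.Product using (_,_; proj₁; proj₂)
open import Data.Sum using (inj₁; inj₂)
open import Data.Empty using (⊥-elim)
open import Function using (_∘_)
open import Relation.Nullary using (¬_; Dec; ¬?; _×-dec_; _⊎-dec_)
open import Relation.Nullary.Decidable using (map′; decidable-stable)
open import Relation.Binary.PropositionalEquality
  using (_≡_; _≢_; refl; sym; trans; cong; subst; module ≡-Reasoning)

unique⇒length≤ : {A : Set} {xs ys : List A} → Unique xs → xs ⊆ ys →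
                 length xs ≤ length ys
unique⇒length≤ {xs = []} _ _ = z≤n
unique⇒length≤ {xs = x ∷ xs} {ys} (x∉xs ∷ uxs) xs⊆ys
  with as , bs , refl ← ∈-∃++ (xs⊆ys (here refl)) = begin
    suc (length xs)             ≤⟨ s≤s (unique⇒length≤ uxs xs⊆as++bs) ⟩
    suc (length (as ++ bs))     ≡⟨ cong suc (length-++ as) ⟩
    suc (length as + length bs) ≡⟨ +-suc (length as) (length bs) ⟨
    length as + length (x ∷ bs) ≡⟨ length-++ as ⟨
    length (as ++ x ∷ bs)       ∎
  where
  open ≤-Reasoning
  xs⊆as++bs : xs ⊆ as ++ bs
  xs⊆as++bs y∈xs with ∈-++⁻ as (xs⊆ys (there y∈xs))
  ... | inj₁ y∈as         = ∈-++⁺ˡ y∈as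
  ... | inj₂ (here refl)  = ⊥-elim (lookup x∉xs y∈xs refl)
  ... | inj₂ (there y∈bs) = ∈-++⁺ʳ as y∈bs

prefix-of-applyUpTo : {A : Set} (f : ℕ → A) (n : ℕ) (xs : List A) {ys : List A} →
                      xs ++ ys ≡ applyUpTo f n → xs ≡ applyUpTo f (length xs)
prefix-of-applyUpTo f n       []       eq = refl
prefix-of-applyUpTo f zero    (x ∷ xs) ()
prefix-of-applyUpTo f (suc n) (x ∷ xs) eq with refl , eq′ ← ∷-injective eq =
  cong (f 0 ∷_) (prefix-of-applyUpTo (f ∘ suc) n xs eq′)

between? : {P : ℕ → Set} → (∀ m → Dec (P m)) → ∀ N →
           Dec (∃[ m ] (1 ≤ m × m ≤ N × P m))
between? P? N =
  map′ (λ (m , m<1+N , 1≤m , pm) → m , 1≤m , s≤s⁻¹ m<1+N , pm)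
       (λ (m , 1≤m , m≤N , pm) → m , s≤s m≤N , 1≤m , pm)
       (anyUpTo? (λ m → (1 ≤? m) ×-dec P? m) (suc N))

signed : ℕ → List ℤ
signed zero    = []
signed (suc k) = + suc k ∷ -[1+ k ] ∷ signed k

signed-length : ∀ k → length (signed k) ≡ 2 * k
signed-length zero    = refl
signed-length (suc k) = trans (cong (suc ∘ suc) (signed-length k)) (sym (*-suc 2 k))

∈-signed⁻ : ∀ {k x} → x ∈ signed k → InSigned k x
∈-signed⁻ {suc k} (here refl)         = (λ ()) , ≤-refl
∈-signed⁻ {suc k} (there (here refl)) = (λ ()) , ≤-refl
∈-signed⁻ {suc k} (there (there x∈))  =
  proj₁ (∈-signed⁻ x∈) , m≤n⇒m≤1+n (proj₂ (∈-signed⁻ x∈))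

∈-signed⁺ : ∀ k x → InSigned k x → x ∈ signed k
∈-signed⁺ k (+ zero) (x≢0 , _) = ⊥-elim (x≢0 refl)
∈-signed⁺ (suc k) (+ suc j) (_ , j<k+1) with m≤n⇒m<n∨m≡n j<k+1
... | inj₂ refl = here refl
... | inj₁ j<k  = there (there (∈-signed⁺ k (+ suc j) ((λ ()) , s≤s⁻¹ j<k)))
∈-signed⁺ (suc k) -[1+ j ] (_ , j<k+1) with m≤n⇒m<n∨m≡n j<k+1
... | inj₂ refl = there (here refl)
... | inj₁ j<k  = there (there (∈-signed⁺ k -[1+ j ] ((λ ()) , s≤s⁻¹ j<k)))

signed-unique : ∀ k → Unique (signed k)
signed-unique zero    = []
signed-unique (suc k) = ((λ ()) ∷ fresh ≤-refl) ∷ fresh ≤-refl ∷ signed-unique k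
  where
  fresh : ∀ {x} → k < ∣ x ∣ → All (x ≢_) (signed k)
  fresh k<∣x∣ = ¬Any⇒All¬ (signed k) (λ x∈ → <⇒≱ k<∣x∣ (proj₂ (∈-signed⁻ x∈)))

Unbalanced : ℕ → List ℤ → Set
Unbalanced n p = ∃[ j ] (1 ≤ j × j ≤ n × ExactlyOneOf j p)

unbalanced? : ∀ n p → Dec (Unbalanced n p)
unbalanced? n p = between? exactlyOneOf? n
  where
  exactlyOneOf? : ∀ j → Dec (ExactlyOneOf j p)
  exactlyOneOf? j = (+ j ∈? p ×-dec ¬? (- + j ∈? p))
               ⊎-dec (¬? (+ j ∈? p) ×-dec - + j ∈? p)

module StandardPrefixes {n : ℕ} {w : Word} (std : IsStandard n w) where

  private
    entries : All (InSigned n) w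
    entries = proj₁ (proj₁ std)

    no-repeats : Unique w
    no-repeats = proj₁ (proj₂ (proj₁ std))

    covers : ∀ x → InSigned n x → x ∈ w
    covers = proj₂ (proj₂ (proj₁ std))

    negatives-in-order : filter (λ x → x <? 0ℤ) w ≡ negatives n
    negatives-in-order = proj₂ (proj₂ std)

  -- π contains all 2n letters, so its prefix of length m ≤ 2n has m letters.
  length-prefix : ∀ {m} → m ≤ 2 * n → length (take m w) ≡ m
  length-prefix {m} m≤2n =
    trans (length-take m w) (m≤n⇒m⊓n≡m (≤-trans m≤2n 2n≤length))
    where
    2n≤length : 2 * n ≤ length w
    2n≤length = subst (_≤ length w) (signed-length n)
      (unique⇒length≤ (signed-unique n) (λ x∈ → covers _ (∈-signed⁻ x∈)))

  prefix-entry : ∀ m {x} → x ∈ take m w → InSigned n x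
  prefix-entry m = lookup (all-take⁺ m entries)

  prefix-unique : ∀ m → Unique (take m w)
  prefix-unique m = Unique.take⁺ m no-repeats

  neg? : (x : ℤ) → Dec (x ℤ.< 0ℤ)
  neg? x = x <? 0ℤ

  negCount : ℕ → ℕ
  negCount m = length (filter neg? (take m w))

  -- The negative letters of π(1)…π(m) are -1, …, -negCount m, being a
  -- prefix of the sequence -1, …, -n of all negative letters of π.
  negatives-of-prefix : ∀ m → filter neg? (take m w) ≡ applyUpTo -[1+_] (negCount m)
  negatives-of-prefix m = prefix-of-applyUpTo -[1+_] n _ (begin
    filter neg? (take m w) ++ filter neg? (drop m w) ≡⟨ filter-++ neg? (take m w) (drop m w) ⟨
    filter neg? (take m w ++ drop m w)               ≡⟨ cong (filter neg?) (take++drop≡id m w) ⟩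
    filter neg? w                                    ≡⟨ negatives-in-order ⟩
    negatives n                                      ≡⟨ map-upTo -[1+_] n ⟩
    applyUpTo -[1+_] n                               ∎)
    where open ≡-Reasoning

  neg∈prefix⇒ : ∀ m {t} → -[1+ t ] ∈ take m w → t < negCount m
  neg∈prefix⇒ m t∈ with _ , t<k , refl ← ∈-applyUpTo⁻ -[1+_]
    (subst (_ ∈_) (negatives-of-prefix m) (∈-filter⁺ neg? t∈ -<+)) = t<k

  neg∈prefix⇐ : ∀ m {t} → t < negCount m → -[1+ t ] ∈ take m w
  neg∈prefix⇐ m t<k = proj₁ (∈-filter⁻ neg?
    (subst (_ ∈_) (sym (negatives-of-prefix m)) (∈-applyUpTo⁺ -[1+_] t<k)))

  -- A balanced prefix π(1)…π(m) is exactly {±1,…,±k} for k = negCount m.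
  module Balanced {m : ℕ} (balanced : ¬ Unbalanced n (take m w)) where

    pos⇒neg : ∀ {t} → + suc t ∈ take m w → -[1+ t ] ∈ take m w
    pos⇒neg {t} t∈ = decidable-stable (-[1+ t ] ∈? take m w) λ -t∉ →
      balanced (suc t , s≤s z≤n , proj₂ (prefix-entry m t∈) , inj₁ (t∈ , -t∉))

    neg⇒pos : ∀ {t} → -[1+ t ] ∈ take m w → + suc t ∈ take m w
    neg⇒pos {t} -t∈ = decidable-stable (+ suc t ∈? take m w) λ t∉ →
      balanced (suc t , s≤s z≤n , proj₂ (prefix-entry m -t∈) , inj₂ (t∉ , -t∈))

    ⊆signed : ∀ {x} → x ∈ take m w → InSigned (negCount m) x
    ⊆signed { -[1+ t ]} -t∈ = (λ ()) , neg∈prefix⇒ m -t∈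
    ⊆signed {+ zero}    0∈  = ⊥-elim (proj₁ (prefix-entry m 0∈) refl)
    ⊆signed {+ suc t}   t∈  = (λ ()) , neg∈prefix⇒ m (pos⇒neg t∈)

    signed⊆ : ∀ x → InSigned (negCount m) x → x ∈ take m w
    signed⊆ -[1+ t ]  (_ , t<k)   = neg∈prefix⇐ m t<k
    signed⊆ (+ zero)  (x≢0 , _)   = ⊥-elim (x≢0 refl)
    signed⊆ (+ suc t) (_ , t<k)   = neg⇒pos (neg∈prefix⇐ m t<k)

    length-balanced : m ≤ 2 * n → m ≡ 2 * negCount m
    length-balanced m≤2n = ≤-antisym
      (begin
        m                            ≡⟨ length-prefix m≤2n ⟨
        length (take m w)            ≤⟨ unique⇒length≤ (prefix-unique m)
                                          (λ x∈ → ∈-signed⁺ _ _ (⊆signed x∈)) ⟩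
        length (signed (negCount m)) ≡⟨ signed-length (negCount m) ⟩
        2 * negCount m               ∎)
      (begin
        2 * negCount m               ≡⟨ signed-length (negCount m) ⟨
        length (signed (negCount m)) ≤⟨ unique⇒length≤ (signed-unique (negCount m))
                                          (λ x∈ → signed⊆ _ (∈-signed⁻ x∈)) ⟩
        length (take m w)            ≡⟨ length-prefix m≤2n ⟩
        m                            ∎)
      where open ≤-Reasoning

  balanced-prefix : ∀ {m} → 1 ≤ m → m < 2 * n → ¬ Unbalanced n (take m w) →
    ∃[ i ] (1 ≤ i × i ≤ n ∸ 1 × All (λ x → ∣ x ∣ ≤ i) (take (2 * i) w))
  balanced-prefix {m} 1≤m m<2n balanced =
    k , 1≤k , ∸-monoˡ-≤ 1 k<n ,
    subst (λ l → All (λ x → ∣ x ∣ ≤ k) (take l w)) m≡2k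
          (All.tabulate (proj₂ ∘ ⊆signed))
    where
    open Balanced balanced
    k : ℕ
    k = negCount m
    m≡2k : m ≡ 2 * k
    m≡2k = length-balanced (<⇒≤ m<2n)
    1≤k : 1 ≤ k
    1≤k = *-cancelˡ-< 2 0 k (subst (1 ≤_) m≡2k 1≤m)
    k<n : k < n
    k<n = *-cancelˡ-< 2 k n (subst (_< 2 * n) m≡2k m<2n)

  bounded-prefix-full : ∀ {i} → i ≤ n → All (λ x → ∣ x ∣ ≤ i) (take (2 * i) w) →
                        ∀ y → InSigned i y → y ∈ take (2 * i) w
  bounded-prefix-full {i} i≤n bounded y y∈± =
    decidable-stable (y ∈? take (2 * i) w) λ y∉ → <-irrefl refl (begin
      suc (2 * i)                   ≡⟨ cong suc (length-prefix (*-monoʳ-≤ 2 i≤n)) ⟨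
      length (y ∷ take (2 * i) w)   ≤⟨ unique⇒length≤ (¬Any⇒All¬ _ y∉ ∷ prefix-unique (2 * i))
                                                     y∷prefix⊆signed ⟩
      length (signed i)             ≡⟨ signed-length i ⟩
      2 * i                         ∎)
    where
    open ≤-Reasoning
    y∷prefix⊆signed : (y ∷ take (2 * i) w) ⊆ signed i
    y∷prefix⊆signed (here refl) = ∈-signed⁺ i y y∈±
    y∷prefix⊆signed (there x∈)  =
      ∈-signed⁺ i _ (proj₁ (prefix-entry (2 * i) x∈) , lookup bounded x∈)

  bounded-prefix-balanced : ∀ {i} → i ≤ n → All (λ x → ∣ x ∣ ≤ i) (take (2 * i) w) →
                            ¬ Unbalanced n (take (2 * i) w)
  bounded-prefix-balanced i≤n bounded (suc t , _ , _ , inj₁ (t∈ , -t∉)) =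
    -t∉ (bounded-prefix-full i≤n bounded -[1+ t ] ((λ ()) , lookup bounded t∈))
  bounded-prefix-balanced i≤n bounded (suc t , _ , _ , inj₂ (t∉ , -t∈)) =
    t∉ (bounded-prefix-full i≤n bounded (+ suc t) ((λ ()) , lookup bounded -t∈))

lemma2p4 : (n : ℕ) → 1 ≤ n → (w : Word) → IsStandard n w →
    SignDisconnected n w ⇔
      (∃[ i ] (1 ≤ i × i ≤ n ∸ 1 × All (λ x → ∣ x ∣ ≤ i) (take (2 * i) w)))
lemma2p4 zero    ()
lemma2p4 (suc n) _ w std = mk⇔ disconnected⇒split split⇒disconnected
  where
  open StandardPrefixes std

  Split : Set
  Split = ∃[ i ] (1 ≤ i × i ≤ n × All (λ x → ∣ x ∣ ≤ i) (take (2 * i) w))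

  split? : Dec Split
  split? = between? (λ i → all? (λ x → ∣ x ∣ ≤? i) (take (2 * i) w)) n

  disconnected⇒split : SignDisconnected (suc n) w → Split
  disconnected⇒split disconnected = decidable-stable split? λ no-split →
    disconnected λ m 1≤m m<2n →
      decidable-stable (unbalanced? (suc n) (take m w))
                       (no-split ∘ balanced-prefix 1≤m m<2n)

  split⇒disconnected : Split → SignDisconnected (suc n) w
  split⇒disconnected (i , 1≤i , i≤n , bounded) connected =
    bounded-prefix-balanced (m≤n⇒m≤1+n i≤n) bounded
      (connected (2 * i) (≤-trans 1≤i (m≤m+n i _)) (*-monoʳ-< 2 (s≤s i≤n)))
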